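{- Let $q$ be a prime power, $\alpha$ a primitive element of $\mathbb{F}_{q^5}$ (identified with $\mathbb{F}_q^5$), $s=\frac{q^5-1}{q-1}$, and $1\le i\le s-1$. If $\langle\alpha^t,\alpha^{t+i}\rangle$ and $\langle\alpha^\ell,\alpha^{\ell+i}\rangle$ are two distinct $2$-dimensional subspaces contained in a $3$-dimensional subspace $Z$ of $\mathbb{F}_q^5$, then $Z=\langle\alpha^r,\alpha^{r+i},\alpha^{r+2i}\rangle$ for some $r$ with $0\le r\le s-1$.
   Context: $\langle v_1,\ldots,v_m\rangle$ denotes the $\mathbb{F}_q$-linear span. -}

module Defs where

open import Level using (Level; _⊔_) renaming (suc to lsuc)
import Data.Nat as ℕ
open ℕ using (ℕ; zero; suc)
open import Data.Nat.Primality using (Prime)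
open import Data.Fin using (Fin; zero; suc)
open import Data.Product using (Σ; ∃; _×_; _,_)
open import Data.Unit.Polymorphic using (⊤)
open import Relation.Binary.PropositionalEquality using (_≡_)
open import Relation.Nullary using (¬_)
open import Algebra.Bundles using (CommutativeRing)
open import Algebra.Morphism.Structures using (module RingMorphisms)

IsPrimePower : ℕ → Set
IsPrimePower q = Σ ℕ λ p → Σ ℕ λ k → Prime p × q ≡ p ℕ.^ suc k

IsField : ∀ {c ℓ} → CommutativeRing c ℓ → Set (c ⊔ ℓ)
IsField R = ¬ (0# ≈ 1#) × (∀ x → ¬ (x ≈ 0#) → ∃ λ y → x * y ≈ 1#)
  where open CommutativeRing R

HasCard : ∀ {c ℓ} → CommutativeRing c ℓ → ℕ → Set (c ⊔ ℓ)
HasCard R n = Σ (Fin n → Carrier) λ f →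
  (∀ i j → f i ≈ f j → i ≡ j) × (∀ x → ∃ λ i → f i ≈ x)
  where open CommutativeRing R

record FieldExt (k₁ k₂ l₁ l₂ : Level) : Set (lsuc (k₁ ⊔ k₂ ⊔ l₁ ⊔ l₂)) where
  field
    K : CommutativeRing k₁ k₂
    L : CommutativeRing l₁ l₂
    K-field : IsField K
    L-field : IsField L
    ι : CommutativeRing.Carrier K → CommutativeRing.Carrier L
    ι-hom : RingMorphisms.IsRingHomomorphism
              (CommutativeRing.rawRing K) (CommutativeRing.rawRing L) ι

module LinAlg {k₁ k₂ l₁ l₂} (E : FieldExt k₁ k₂ l₁ l₂) where
  open FieldExt E
  module K = CommutativeRing K
  open CommutativeRing L using (Carrier; _≈_; _+_; _*_; 0#; 1#)

  pow : Carrier → ℕ → Carrier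
  pow a zero = 1#
  pow a (suc n) = a * pow a n

  IsPrimitive : Carrier → Set (l₁ ⊔ l₂)
  IsPrimitive a = ∀ x → ¬ (x ≈ 0#) → ∃ λ n → x ≈ pow a n

  lincomb : ∀ {m} → (Fin m → K.Carrier) → (Fin m → Carrier) → Carrier
  lincomb {zero} c v = 0#
  lincomb {suc m} c v = ι (c zero) * v zero + lincomb (λ j → c (suc j)) (λ j → v (suc j))

  Span : ∀ {m} → (Fin m → Carrier) → Carrier → Set (k₁ ⊔ l₂)
  Span v x = ∃ λ c → x ≈ lincomb c v

  LinIndep : ∀ {m} → (Fin m → Carrier) → Set (k₁ ⊔ k₂ ⊔ l₂)
  LinIndep v = ∀ c → lincomb c v ≈ 0# → ∀ j → c j K.≈ K.0#

  _⊆_ : ∀ {a b} → (Carrier → Set a) → (Carrier → Set b) → Set (l₁ ⊔ a ⊔ b)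
  P ⊆ Q = ∀ x → P x → Q x

  _≐_ : ∀ {a b} → (Carrier → Set a) → (Carrier → Set b) → Set (l₁ ⊔ a ⊔ b)
  P ≐ Q = (P ⊆ Q) × (Q ⊆ P)

  IsSubspaceOfDim : ∀ {a} → (Carrier → Set a) → ℕ → Set (k₁ ⊔ k₂ ⊔ l₁ ⊔ l₂ ⊔ a)
  IsSubspaceOfDim W d = Σ (Fin d → Carrier) λ b → LinIndep b × (W ≐ Span b)

  vec2 : Carrier → Carrier → Fin 2 → Carrier
  vec2 a b zero = a
  vec2 a b (suc zero) = b

  vec3 : Carrier → Carrier → Carrier → Fin 3 → Carrier
  vec3 a b c zero = a
  vec3 a b c (suc zero) = b
  vec3 a b c (suc (suc zero)) = c

-- s = (q^5 - 1)/(q - 1), written as 1 + q + q^2 + q^3 + q^4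
sNum : ℕ → ℕ
sNum q = 1 ℕ.+ q ℕ.+ q ℕ.^ 2 ℕ.+ q ℕ.^ 3 ℕ.+ q ℕ.^ 4

module Submission where

-- Lemma 8.  Let β = αⁱ, A = αᵗ and B = αˡ.  The four vectors A, Aβ, B, Bβ of
-- the 3-dimensional space Z satisfy a nontrivial K-linear relation (exchange
-- lemma), which factors as A·P + B·Q = 0 with P = k₀ + k₁β and Q = k₂ + k₃β.
-- For c = A/Q this gives A = cQ and B = −cP, so both planes lie in the span of
-- C = (c, cβ, cβ²).  C is independent, since otherwise both planes would equal
-- the plane spanned by two vectors of C.  C lies in Z: the determinant
-- D = k₀k₃ − k₁k₂ is nonzero (D = 0 makes P and Q proportional and the planes
-- equal), and D·c, D·cβ, D·cβ² are K-combinations of cP, cQ, cβP, cβQ ∈ Z.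
-- Three independent vectors of Z span it, so Z = ⟨c, cβ, cβ²⟩.  Finally
-- c = αⁿ by primitivity, and since L ≅ K⁵ has only s = 1 + q + … + q⁴ lines,
-- the pigeonhole principle gives 0 < d ≤ s with α^d ∈ K, so αⁿ ∈ K·α^r, r < d.

open import Defs
open import Level using (Level)
open import Algebra.Bundles using (CommutativeRing)
open import Algebra.Morphism.Structures using (module RingMorphisms)
import Algebra.Definitions.RawMonoid as RawMonoidDefinitions
import Algebra.Properties.CommutativeSemigroup as CommutativeSemigroupProperties
import Algebra.Properties.Group as GroupProperties
import Algebra.Properties.Ring as RingProperties
import Algebra.Solver.Ring.NaturalCoefficients.Default as NatSolver
import Relation.Binary.Reasoning.Setoid as SetoidReasoning
import Data.Nat as ℕ
open ℕ using (ℕ; zero; suc; NonZero)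
import Data.Nat.Properties as ℕ
open import Data.Nat.DivMod using (_%_; _/_; m≡m%n+[m/n]*n; m%n<n)
open import Data.Fin using (Fin; zero; suc; punchIn)
import Data.Fin as Fin
import Data.Fin.Properties as Fin
open import Data.Vec.Functional using (insertAt; _∷_)
open import Data.Vec.Functional.Properties using (insertAt-lookup; insertAt-punchIn)
open import Data.Product using (Σ; ∃; _×_; _,_; proj₁; proj₂)
open import Data.Sum using (_⊎_; inj₁; inj₂)
import Data.Sum.Properties as Sum
open import Data.Empty using (⊥-elim)
open import Relation.Nullary using (¬_; Dec; yes; no; ¬?)
import Relation.Binary.PropositionalEquality as ≡
open ≡ using (_≡_; _≢_)
open import Function using (_∘_)

module _ {c ℓ} (R : CommutativeRing c ℓ) where
  open CommutativeRing R

  finite⇒decidable : (n : ℕ) → HasCard R n → ∀ x y → Dec (x ≈ y)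
  finite⇒decidable n (f , f-injective , f-onto) x y with f-onto x | f-onto y
  ... | i , fi≈x | j , fj≈y with i Fin.≟ j
  ...   | yes ≡.refl = yes (trans (sym fi≈x) fj≈y)
  ...   | no i≢j = no λ x≈y → i≢j (f-injective i j (trans fi≈x (trans x≈y (sym fj≈y))))

-- The whole development lives over a field extension L / K whose scalar field K
-- has decidable equality; this is what makes pivoting in elimination possible.
module Theory {kc kℓ lc lℓ} (E : FieldExt kc kℓ lc lℓ)
  (_≟K_ : ∀ x y → Dec (CommutativeRing._≈_ (FieldExt.K E) x y)) where
  open FieldExt E
  open LinAlg E
  open CommutativeRing L hiding (zero)
  open RingMorphisms.IsRingHomomorphism ι-hom using () renaming
    (⟦⟧-cong to ι-cong; +-homo to ι-+; *-homo to ι-*; 0#-homo to ι-0; 1#-homo to ι-1; -‿homo to ι-neg)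
  open RingProperties ring using (-‿distribˡ-*; -1*x≈-x; x[y-z]≈xy-xz)
  open GroupProperties +-group using (inverseˡ-unique; x∙y⁻¹≈ε⇒x≈y; x≈y⇒x∙y⁻¹≈ε; ⁻¹-involutive)
  open CommutativeSemigroupProperties *-commutativeSemigroup
    using (xy∙z≈y∙xz; x∙yz≈yx∙z; x∙yz≈y∙xz; xy∙z≈xz∙y)
  open CommutativeSemigroupProperties +-commutativeSemigroup
    using () renaming (x∙yz≈y∙xz to +-swapˡ; interchange to +-interchange)
  open NatSolver commutativeSemiring using (solve; _:+_; _:*_; _:=_)
  open SetoidReasoning setoid

  Scalar : Set kc
  Scalar = K.Carrier

  move-terms : ∀ a b x y → a + y ≈ b + x → a - x ≈ b - y
  move-terms a b x y a+y≈b+x = begin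
    a - x                ≈⟨ +-identityʳ _ ⟨
    (a - x) + 0#         ≈⟨ +-congˡ (-‿inverseʳ y) ⟨
    (a - x) + (y - y)    ≈⟨ +-interchange a (- x) y (- y) ⟩
    (a + y) + (- x - y)  ≈⟨ +-cong a+y≈b+x (+-comm _ _) ⟩
    (b + x) + (- y - x)  ≈⟨ +-interchange b x (- y) (- x) ⟩
    (b - y) + (x - x)    ≈⟨ +-congˡ (-‿inverseʳ x) ⟩
    (b - y) + 0#         ≈⟨ +-identityʳ _ ⟩
    b - y                ∎

  invL : (x : Carrier) → ¬ x ≈ 0# → Carrier
  invL x x≉0 = proj₁ (proj₂ L-field x x≉0)

  invL-r : ∀ x (x≉0 : ¬ x ≈ 0#) → x * invL x x≉0 ≈ 1#
  invL-r x x≉0 = proj₂ (proj₂ L-field x x≉0)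

  invK : (κ : Scalar) → ¬ κ K.≈ K.0# → Scalar
  invK κ κ≉0 = proj₁ (proj₂ K-field κ κ≉0)

  invK-r : ∀ κ (κ≉0 : ¬ κ K.≈ K.0#) → κ K.* invK κ κ≉0 K.≈ K.1#
  invK-r κ κ≉0 = proj₂ (proj₂ K-field κ κ≉0)

  K-unnormalise : ∀ x y (y≉0 : ¬ y K.≈ K.0#) → (x K.* invK y y≉0) K.* y K.≈ x
  K-unnormalise x y y≉0 = K.trans (K.*-assoc _ _ _)
    (K.trans (K.*-congˡ (K.trans (K.*-comm _ _) (invK-r y y≉0))) (K.*-identityʳ x))

  0≉1 : ¬ 0# ≈ 1#
  0≉1 = proj₁ L-field

  K-1≉0 : ¬ K.1# K.≈ K.0#
  K-1≉0 1≈0 = proj₁ K-field (K.sym 1≈0)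

  nonzero-cancel : ∀ {x y} → ¬ x ≈ 0# → x * y ≈ 0# → y ≈ 0#
  nonzero-cancel {x} {y} x≉0 xy≈0 = begin
    y                     ≈⟨ *-identityˡ y ⟨
    1# * y                ≈⟨ *-congʳ (invL-r x x≉0) ⟨
    (x * invL x x≉0) * y  ≈⟨ xy∙z≈y∙xz x (invL x x≉0) y ⟩
    invL x x≉0 * (x * y)  ≈⟨ *-congˡ xy≈0 ⟩
    invL x x≉0 * 0#       ≈⟨ zeroʳ _ ⟩
    0#                    ∎

  *-nonzero : ∀ {x y} → ¬ x ≈ 0# → ¬ y ≈ 0# → ¬ x * y ≈ 0#
  *-nonzero x≉0 y≉0 xy≈0 = y≉0 (nonzero-cancel x≉0 xy≈0)

  *-cancelˡ-nonzero : ∀ {x u v} → ¬ x ≈ 0# → x * u ≈ x * v → u ≈ v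
  *-cancelˡ-nonzero x≉0 xu≈xv =
    x∙y⁻¹≈ε⇒x≈y _ _ (nonzero-cancel x≉0 (trans (x[y-z]≈xy-xz _ _ _) (x≈y⇒x∙y⁻¹≈ε xu≈xv)))

  ι-unscale : ∀ κ (κ≉0 : ¬ κ K.≈ K.0#) x → ι (invK κ κ≉0) * (ι κ * x) ≈ x
  ι-unscale κ κ≉0 x = begin
    ι (invK κ κ≉0) * (ι κ * x)  ≈⟨ x∙yz≈yx∙z (ι (invK κ κ≉0)) (ι κ) x ⟩
    (ι κ * ι (invK κ κ≉0)) * x  ≈⟨ *-congʳ (ι-* κ _) ⟨
    ι (κ K.* invK κ κ≉0) * x    ≈⟨ *-congʳ (trans (ι-cong (invK-r κ κ≉0)) ι-1) ⟩
    1# * x                      ≈⟨ *-identityˡ x ⟩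
    x                           ∎

  ι-zero-scale : ∀ {κ} → κ K.≈ K.0# → ∀ x → ι κ * x ≈ 0#
  ι-zero-scale κ≈0 x = trans (*-congʳ (trans (ι-cong κ≈0) ι-0)) (zeroˡ x)

  drop-zero-term : ∀ {κ} → κ K.≈ K.0# → ∀ x y → ι κ * x + y ≈ y
  drop-zero-term κ≈0 x y = trans (+-congʳ (ι-zero-scale κ≈0 x)) (+-identityˡ y)

  pow-cong : ∀ {x y} n → x ≈ y → pow x n ≈ pow y n
  pow-cong zero x≈y = refl
  pow-cong (suc n) x≈y = *-cong x≈y (pow-cong n x≈y)

  pow-+ : ∀ x m n → pow x (m ℕ.+ n) ≈ pow x m * pow x n
  pow-+ x zero n = sym (*-identityˡ _)
  pow-+ x (suc m) n = trans (*-congˡ (pow-+ x m n)) (sym (*-assoc _ _ _))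

  pow-* : ∀ x m d → pow x (m ℕ.* d) ≈ pow (pow x d) m
  pow-* x zero d = refl
  pow-* x (suc m) d = trans (pow-+ x d (m ℕ.* d)) (*-congˡ (pow-* x m d))

  pow-nonzero : ∀ {x} → ¬ x ≈ 0# → ∀ n → ¬ pow x n ≈ 0#
  pow-nonzero x≉0 zero 1≈0 = 0≉1 (sym 1≈0)
  pow-nonzero x≉0 (suc n) = *-nonzero x≉0 (pow-nonzero x≉0 n)

  pow-of-zero : ∀ {x} → x ≈ 0# → ∀ n → 0 ℕ.< n → pow x n ≈ 0#
  pow-of-zero x≈0 (suc n) _ = trans (*-congʳ x≈0) (zeroˡ _)

  pow-ι : ∀ μ n → ∃ λ κ → pow (ι μ) n ≈ ι κ
  pow-ι μ zero = K.1# , sym ι-1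
  pow-ι μ (suc n) = μ K.* proj₁ (pow-ι μ n) , trans (*-congˡ (proj₂ (pow-ι μ n))) (sym (ι-* _ _))

  lc-cong : ∀ {m} {c d : Fin m → Scalar} {v u : Fin m → Carrier} →
    (∀ j → c j K.≈ d j) → (∀ j → v j ≈ u j) → lincomb c v ≈ lincomb d u
  lc-cong {zero} c≈d v≈u = refl
  lc-cong {suc m} c≈d v≈u =
    +-cong (*-cong (ι-cong (c≈d zero)) (v≈u zero)) (lc-cong (c≈d ∘ suc) (v≈u ∘ suc))

  lc-zero : ∀ {m} (c : Fin m → Scalar) (v : Fin m → Carrier) → (∀ j → c j K.≈ K.0#) → lincomb c v ≈ 0#
  lc-zero {zero} c v c≈0 = refl
  lc-zero {suc m} c v c≈0 =
    trans (drop-zero-term (c≈0 zero) (v zero) _) (lc-zero (c ∘ suc) (v ∘ suc) (c≈0 ∘ suc))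

  lc-add : ∀ {m} (c d : Fin m → Scalar) (v : Fin m → Carrier) →
    lincomb (λ j → c j K.+ d j) v ≈ lincomb c v + lincomb d v
  lc-add {zero} c d v = sym (+-identityʳ 0#)
  lc-add {suc m} c d v = begin
    ι (c zero K.+ d zero) * v zero + lincomb (λ j → c (suc j) K.+ d (suc j)) (v ∘ suc)
      ≈⟨ +-cong (*-congʳ (ι-+ _ _)) (lc-add (c ∘ suc) (d ∘ suc) (v ∘ suc)) ⟩
    (ι (c zero) + ι (d zero)) * v zero + (lincomb (c ∘ suc) (v ∘ suc) + lincomb (d ∘ suc) (v ∘ suc))
      ≈⟨ regroup _ _ _ _ _ ⟩
    lincomb c v + lincomb d v ∎
    where
      regroup : ∀ a b x p q → (a + b) * x + (p + q) ≈ (a * x + p) + (b * x + q)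
      regroup = solve 5 (λ a b x p q → (a :+ b) :* x :+ (p :+ q) := (a :* x :+ p) :+ (b :* x :+ q)) refl

  lc-scale : ∀ {m} (κ : Scalar) (c : Fin m → Scalar) (v : Fin m → Carrier) →
    lincomb (λ j → κ K.* c j) v ≈ ι κ * lincomb c v
  lc-scale {zero} κ c v = sym (zeroʳ _)
  lc-scale {suc m} κ c v = begin
    ι (κ K.* c zero) * v zero + lincomb (λ j → κ K.* c (suc j)) (v ∘ suc)
      ≈⟨ +-cong (*-congʳ (ι-* _ _)) (lc-scale κ (c ∘ suc) (v ∘ suc)) ⟩
    (ι κ * ι (c zero)) * v zero + ι κ * lincomb (c ∘ suc) (v ∘ suc)
      ≈⟨ regroup _ _ _ _ ⟩
    ι κ * lincomb c v ∎
    where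
      regroup : ∀ k a x p → (k * a) * x + k * p ≈ k * (a * x + p)
      regroup = solve 4 (λ k a x p → (k :* a) :* x :+ k :* p := k :* (a :* x :+ p)) refl

  lc-extract : ∀ {m} (j : Fin (suc m)) (c : Fin (suc m) → Scalar) (v : Fin (suc m) → Carrier) →
    lincomb c v ≈ ι (c j) * v j + lincomb (c ∘ punchIn j) (v ∘ punchIn j)
  lc-extract zero c v = refl
  lc-extract {suc m} (suc j) c v =
    trans (+-congˡ (lc-extract j (c ∘ suc) (v ∘ suc))) (+-swapˡ _ _ _)

  open RawMonoidDefinitions K.+-rawMonoid using (sum)

  lc-shift : ∀ {m} (d ν : Fin m → Scalar) (u : Fin m → Carrier) (x : Carrier) →
    lincomb d (λ k → u k + ι (ν k) * x) ≈ lincomb d u + ι (sum (λ k → d k K.* ν k)) * x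
  lc-shift {zero} d ν u x = sym (trans (+-identityˡ _) (trans (*-congʳ ι-0) (zeroˡ x)))
  lc-shift {suc m} d ν u x = begin
    ι (d zero) * (u zero + ι (ν zero) * x) + lincomb (d ∘ suc) (λ k → u (suc k) + ι (ν (suc k)) * x)
      ≈⟨ +-congˡ (lc-shift (d ∘ suc) (ν ∘ suc) (u ∘ suc) x) ⟩
    ι (d zero) * (u zero + ι (ν zero) * x) + (lincomb (d ∘ suc) (u ∘ suc) + ι rest * x)
      ≈⟨ regroup _ _ _ _ _ _ ⟩
    lincomb d u + (ι (d zero) * ι (ν zero) + ι rest) * x
      ≈⟨ +-congˡ (*-congʳ (trans (+-congʳ (sym (ι-* _ _))) (sym (ι-+ _ _)))) ⟩
    lincomb d u + ι (d zero K.* ν zero K.+ rest) * x ∎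
    where
      rest = sum (λ k → d (suc k) K.* ν (suc k))
      regroup : ∀ a y n z p s → a * (y + n * z) + (p + s * z) ≈ (a * y + p) + (a * n + s) * z
      regroup = solve 6 (λ a y n z p s →
        a :* (y :+ n :* z) :+ (p :+ s :* z) := (a :* y :+ p) :+ (a :* n :+ s) :* z) refl

  span-resp : ∀ {m} (w : Fin m → Carrier) {x y} → x ≈ y → Span w x → Span w y
  span-resp w x≈y (c , x≈wc) = c , trans (sym x≈y) x≈wc

  span-0 : ∀ {m} (w : Fin m → Carrier) → Span w 0#
  span-0 w = (λ _ → K.0#) , sym (lc-zero _ w (λ _ → K.refl))

  span-+ : ∀ {m} (w : Fin m → Carrier) {x y} → Span w x → Span w y → Span w (x + y)
  span-+ w (c , x≈wc) (d , y≈wd) = (λ j → c j K.+ d j) , trans (+-cong x≈wc y≈wd) (sym (lc-add c d w))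

  span-scale : ∀ {m} (w : Fin m → Carrier) κ {x} → Span w x → Span w (ι κ * x)
  span-scale w κ (c , x≈wc) = (λ j → κ K.* c j) , trans (*-congˡ x≈wc) (sym (lc-scale κ c w))

  span-neg : ∀ {m} (w : Fin m → Carrier) {x} → Span w x → Span w (- x)
  span-neg w {x} x∈w = span-resp w ι[-1]x≈-x (span-scale w (K.- K.1#) x∈w)
    where
      ι[-1]x≈-x : ι (K.- K.1#) * x ≈ - x
      ι[-1]x≈-x = trans (*-congʳ (trans (ι-neg _) (-‿cong ι-1))) (-1*x≈-x x)

  span-unneg : ∀ {m} (w : Fin m → Carrier) {x} → Span w (- x) → Span w x
  span-unneg w {x} -x∈w = span-resp w (⁻¹-involutive x) (span-neg w -x∈w)

  span-gen : ∀ {m} (w : Fin m → Carrier) j → Span w (w j)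
  span-gen w zero = (K.1# ∷ λ _ → K.0#) , sym (begin
    ι K.1# * w zero + lincomb (λ _ → K.0#) (w ∘ suc)
      ≈⟨ +-cong (*-congʳ ι-1) (lc-zero (λ _ → K.0#) (w ∘ suc) (λ _ → K.refl)) ⟩
    1# * w zero + 0# ≈⟨ +-identityʳ _ ⟩
    1# * w zero      ≈⟨ *-identityˡ _ ⟩
    w zero           ∎)
  span-gen w (suc j) with span-gen (w ∘ suc) j
  ... | c , wj≈ = (K.0# ∷ c) , trans wj≈ (sym (drop-zero-term K.refl (w zero) _))

  span-lincomb : ∀ {m n} (w : Fin n → Carrier) (v : Fin m → Carrier) →
    (∀ j → Span w (v j)) → ∀ c → Span w (lincomb c v)
  span-lincomb {zero} w v v∈w c = span-0 w
  span-lincomb {suc m} w v v∈w c =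
    span-+ w (span-scale w (c zero) (v∈w zero)) (span-lincomb w (v ∘ suc) (v∈w ∘ suc) (c ∘ suc))

  span-⊆ : ∀ {m n} (w : Fin n → Carrier) (v : Fin m → Carrier) → (∀ j → Span w (v j)) → Span v ⊆ Span w
  span-⊆ w v v∈w x (c , x≈vc) = span-resp w (sym x≈vc) (span-lincomb w v v∈w c)

  span-unscale : ∀ {m} (S : Fin m → Carrier) κ (κ≉0 : ¬ κ K.≈ K.0#) {x} → Span S (ι κ * x) → Span S x
  span-unscale S κ κ≉0 {x} κx∈S = span-resp S (ι-unscale κ κ≉0 x) (span-scale S (invK κ κ≉0) κx∈S)

  span-isolate : ∀ {m} (w : Fin m → Carrier) a (a≉0 : ¬ a K.≈ K.0#) x y →
    ι a * x + y ≈ 0# → Span w y → Span w x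
  span-isolate w a a≉0 x y ax+y≈0 y∈w =
    span-unscale w a a≉0 (span-resp w (sym (inverseˡ-unique _ _ ax+y≈0)) (span-neg w y∈w))

  span-divide : ∀ {m} (S : Fin m → Carrier) {X Y} a (a≉0 : ¬ a K.≈ K.0#) b →
    ι a * X ≈ ι b * Y → Span S Y → Span S X
  span-divide S a a≉0 b aX≈bY Y∈S = span-unscale S a a≉0 (span-resp S (sym aX≈bY) (span-scale S b Y∈S))

  span-transfer : ∀ {m} (S : Fin m → Carrier) {X Y} (a₁ b₁ a₂ b₂ : Scalar) →
    ι a₁ * X ≈ ι b₁ * Y → ι a₂ * X ≈ ι b₂ * Y → ¬ (a₁ K.≈ K.0# × a₂ K.≈ K.0#) → Span S Y → Span S X
  span-transfer S a₁ b₁ a₂ b₂ e₁ e₂ nontrivial Y∈S with a₁ ≟K K.0# | a₂ ≟K K.0#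
  ... | no a₁≉0  | _        = span-divide S a₁ a₁≉0 b₁ e₁ Y∈S
  ... | yes _    | no a₂≉0  = span-divide S a₂ a₂≉0 b₂ e₂ Y∈S
  ... | yes a₁≈0 | yes a₂≈0 = ⊥-elim (nontrivial (a₁≈0 , a₂≈0))

  pair-regroup : ∀ a b x t → a * x + b * (x * t) ≈ x * (a + b * t)
  pair-regroup = solve 4 (λ a b x t → a :* x :+ b :* (x :* t) := x :* (a :+ b :* t)) refl

  span-affine : ∀ {m} (S : Fin m → Carrier) {x β} → Span S x → Span S (x * β) →
    ∀ a b → Span S (x * (ι a + ι b * β))
  span-affine S x∈S xβ∈S a b =
    span-resp S (pair-regroup _ _ _ _) (span-+ S (span-scale S a x∈S) (span-scale S b xβ∈S))

  span-combination : ∀ {m} (S : Fin m → Carrier) a b {x y} → Span S x → Span S y → Span S (ι a * x - ι b * y)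
  span-combination S a b x∈S y∈S = span-+ S (span-scale S a x∈S) (span-neg S (span-scale S b y∈S))

  ≐-trans : ∀ {a b c} {P : Carrier → Set a} {Q : Carrier → Set b} {R : Carrier → Set c} →
    P ≐ Q → Q ≐ R → P ≐ R
  ≐-trans (P⊆Q , Q⊆P) (Q⊆R , R⊆Q) = (λ x → Q⊆R x ∘ P⊆Q x) , (λ x → Q⊆P x ∘ R⊆Q x)

  Dependent : ∀ {m} → (Fin m → Carrier) → Set _
  Dependent {m} v = Σ (Fin m → Scalar) λ c → lincomb c v ≈ 0# × ∃ λ j → ¬ c j K.≈ K.0#

  independent⇒¬dependent : ∀ {m} {v : Fin m → Carrier} → LinIndep v → ¬ Dependent v
  independent⇒¬dependent v-indep (c , vc≈0 , j , cj≉0) = cj≉0 (v-indep c vc≈0 j)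

  -- Since K has decidable equality, independence is the absence of a relation.
  ¬dependent⇒independent : ∀ {m} (v : Fin m → Carrier) → ¬ Dependent v → LinIndep v
  ¬dependent⇒independent v ¬dep c vc≈0 j with c j ≟K K.0#
  ... | yes cj≈0 = cj≈0
  ... | no cj≉0 = ⊥-elim (¬dep (c , vc≈0 , j , cj≉0))

  pivot-kills : ∀ b a₀ (a₀≉0 : ¬ a₀ K.≈ K.0#) → b K.+ (K.- (b K.* invK a₀ a₀≉0)) K.* a₀ K.≈ K.0#
  pivot-kills b a₀ a₀≉0 =
    K.trans (K.+-congˡ (K.trans (K.sym (K-ring.-‿distribˡ-* _ _)) (K.-‿cong (K-unnormalise b a₀ a₀≉0))))
            (K.-‿inverseʳ b)
    where module K-ring = RingProperties K.ring

  eliminate-first : ∀ {m} (w : Fin (suc m) → Carrier) (p q : Fin (suc m) → Scalar) ν {vp vq} →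
    vp ≈ lincomb p w → vq ≈ lincomb q w → p zero K.+ ν K.* q zero K.≈ K.0# →
    Span (w ∘ suc) (vp + ι ν * vq)
  eliminate-first w p q ν {vp} {vq} vp≈ vq≈ p₀+νq₀≈0 = (λ k → p (suc k) K.+ ν K.* q (suc k)) , (begin
    vp + ι ν * vq ≈⟨ +-cong vp≈ (*-congˡ vq≈) ⟩
    (ι (p zero) * w zero + X) + ι ν * (ι (q zero) * w zero + Y)
      ≈⟨ regroup (ι (p zero)) X (ι ν) (ι (q zero)) Y (w zero) ⟩
    (ι (p zero) + ι ν * ι (q zero)) * w zero + (X + ι ν * Y)
      ≈⟨ +-congʳ (*-congʳ (trans (+-congˡ (sym (ι-* ν (q zero)))) (sym (ι-+ _ _)))) ⟩
    ι (p zero K.+ ν K.* q zero) * w zero + (X + ι ν * Y)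
      ≈⟨ drop-zero-term p₀+νq₀≈0 (w zero) _ ⟩
    X + ι ν * Y ≈⟨ +-congˡ (lc-scale ν (q ∘ suc) (w ∘ suc)) ⟨
    X + lincomb (λ k → ν K.* q (suc k)) (w ∘ suc) ≈⟨ lc-add (p ∘ suc) (λ k → ν K.* q (suc k)) (w ∘ suc) ⟨
    lincomb (λ k → p (suc k) K.+ ν K.* q (suc k)) (w ∘ suc) ∎)
    where
      X = lincomb (p ∘ suc) (w ∘ suc)
      Y = lincomb (q ∘ suc) (w ∘ suc)
      regroup : ∀ p x n q y w → (p * w + x) + n * (q * w + y) ≈ (p + n * q) * w + (x + n * y)
      regroup = solve 6 (λ p x n q y w →
        (p :* w :+ x) :+ n :* (q :* w :+ y) := (p :+ n :* q) :* w :+ (x :+ n :* y)) refl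

  lift-relation : ∀ {n} (j : Fin (suc n)) (d ν : Fin n → Scalar) (v : Fin (suc n) → Carrier) →
    lincomb (insertAt d j (sum (λ k → d k K.* ν k))) v ≈ lincomb d (λ k → v (punchIn j k) + ι (ν k) * v j)
  lift-relation j d ν v = begin
    lincomb c v ≈⟨ lc-extract j c v ⟩
    ι (c j) * v j + lincomb (c ∘ punchIn j) (v ∘ punchIn j)
      ≈⟨ +-cong (*-congʳ (ι-cong (K.reflexive (insertAt-lookup d j S))))
                (lc-cong (λ k → K.reflexive (insertAt-punchIn d j S k)) (λ _ → refl)) ⟩
    ι S * v j + lincomb d (v ∘ punchIn j) ≈⟨ +-comm _ _ ⟩
    lincomb d (v ∘ punchIn j) + ι S * v j ≈⟨ lc-shift d ν (v ∘ punchIn j) (v j) ⟨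
    lincomb d (λ k → v (punchIn j k) + ι (ν k) * v j) ∎
    where
      S = sum (λ k → d k K.* ν k)
      c = insertAt d j S

  Exchange : ℕ → Set _
  Exchange n = (w : Fin n → Carrier) (v : Fin (suc n) → Carrier) → (∀ j → Span w (v j)) → Dependent v

  -- Inductive step, pivot case: v j has a nonzero w₀-coordinate.  Eliminating w₀
  -- from the other vectors with v j leaves n+1 vectors in the span of w₁, …, wₙ.
  exchange-pivot : ∀ {n} → Exchange n → (w : Fin (suc n) → Carrier) (v : Fin (suc (suc n)) → Carrier)
    (a : Fin (suc (suc n)) → Fin (suc n) → Scalar) → (∀ j → v j ≈ lincomb (a j) w) →
    ∀ j → ¬ a j zero K.≈ K.0# → Dependent v
  exchange-pivot {n} exchange-n w v a v≈aw j aj₀≉0 = lift (exchange-n (w ∘ suc) shifted reduced)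
    where
      ν : Fin (suc n) → Scalar
      ν k = K.- (a (punchIn j k) zero K.* invK (a j zero) aj₀≉0)
      shifted : Fin (suc n) → Carrier
      shifted k = v (punchIn j k) + ι (ν k) * v j
      reduced : ∀ k → Span (w ∘ suc) (shifted k)
      reduced k = eliminate-first w (a (punchIn j k)) (a j) (ν k) (v≈aw (punchIn j k)) (v≈aw j)
                    (pivot-kills (a (punchIn j k) zero) (a j zero) aj₀≉0)
      lift : Dependent shifted → Dependent v
      lift (d , d-rel , k , dk≉0) =
        insertAt d j S , trans (lift-relation j d ν v) d-rel , punchIn j k ,
          λ ck≈0 → dk≉0 (K.trans (K.reflexive (≡.sym (insertAt-punchIn d j S k))) ck≈0)
        where
          S : Scalar
          S = sum (λ k → d k K.* ν k)

  -- Inductive step, no pivot: all vectors already lie in the span of w₁, …, wₙ,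
  -- so a relation among v₁, …, v_{n+1} suffices.
  exchange-no-pivot : ∀ {n} → Exchange n → (w : Fin (suc n) → Carrier) (v : Fin (suc (suc n)) → Carrier)
    (a : Fin (suc (suc n)) → Fin (suc n) → Scalar) → (∀ j → v j ≈ lincomb (a j) w) →
    (∀ j → a j zero K.≈ K.0#) → Dependent v
  exchange-no-pivot exchange-n w v a v≈aw a₀≈0 = lift (exchange-n (w ∘ suc) (v ∘ suc) v∈w')
    where
      v∈w' : ∀ j → Span (w ∘ suc) (v (suc j))
      v∈w' j = (a (suc j) ∘ suc) , trans (v≈aw (suc j)) (drop-zero-term (a₀≈0 (suc j)) (w zero) _)
      lift : Dependent (v ∘ suc) → Dependent v
      lift (d , d-rel , k , dk≉0) = (K.0# ∷ d) , trans (drop-zero-term K.refl (v zero) _) d-rel , suc k , dk≉0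

  exchange : ∀ n → Exchange n
  exchange zero w v v∈w = (λ _ → K.1#) , v₀≈0 , zero , K-1≉0
    where
      v₀≈0 : ι K.1# * v zero + 0# ≈ 0#
      v₀≈0 = trans (+-identityʳ _) (trans (*-congˡ (proj₂ (v∈w zero))) (zeroʳ _))
  exchange (suc n) w v v∈w with Fin.any? (λ j → ¬? (proj₁ (v∈w j) zero ≟K K.0#))
  ... | yes (j , aj₀≉0) = exchange-pivot (exchange n) w v (λ j → proj₁ (v∈w j)) (λ j → proj₂ (v∈w j)) j aj₀≉0
  ... | no no-pivot = exchange-no-pivot (exchange n) w v (λ j → proj₁ (v∈w j)) (λ j → proj₂ (v∈w j)) a₀≈0
    where
      a₀≈0 : ∀ j → proj₁ (v∈w j) zero K.≈ K.0#
      a₀≈0 j with proj₁ (v∈w j) zero ≟K K.0#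
      ... | yes aj₀≈0 = aj₀≈0
      ... | no aj₀≉0 = ⊥-elim (no-pivot (j , aj₀≉0))

  drop-redundant : ∀ {m} (v : Fin (suc m) → Carrier) → Dependent v → ∃ λ j → Span v ⊆ Span (v ∘ punchIn j)
  drop-redundant v (c , vc≈0 , j , cj≉0) = j , span-⊆ (v ∘ punchIn j) v v∈rest
    where
      v∈rest : ∀ x → Span (v ∘ punchIn j) (v x)
      v∈rest x with x Fin.≟ j
      ... | yes ≡.refl = span-isolate (v ∘ punchIn j) (c j) cj≉0 (v j) _
                           (trans (sym (lc-extract j c v)) vc≈0) (c ∘ punchIn j , refl)
      ... | no x≢j = ≡.subst (λ y → Span (v ∘ punchIn j) (v y)) (Fin.punchIn-punchOut (x≢j ∘ ≡.sym))
                       (span-gen (v ∘ punchIn j) _)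

  spanning⇒independent : ∀ {n} (v : Fin n → Carrier) → IsSubspaceOfDim (Span v) n → LinIndep v
  spanning⇒independent {zero} v _ c _ ()
  spanning⇒independent {suc n} v (b , b-indep , v⊆b , b⊆v) = ¬dependent⇒independent v λ v-dep →
    let (j , v⊆rest) = drop-redundant v v-dep
    in independent⇒¬dependent {v = b} b-indep
         (exchange n (v ∘ punchIn j) b (λ k → v⊆rest (b k) (b⊆v (b k) (span-gen b k))))

  independent-fills : ∀ n (w u : Fin n → Carrier) → LinIndep w → (∀ j → Span u (w j)) → Span u ⊆ Span w
  independent-fills n w u w-indep w∈u x x∈u
    with exchange n u (x ∷ w) (λ { zero → x∈u ; (suc j) → w∈u j })
  ... | c , rel , j , cj≉0 with c zero ≟K K.0#
  ...   | no c₀≉0 = span-isolate w (c zero) c₀≉0 x _ rel (c ∘ suc , refl)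
  ...   | yes c₀≈0 = ⊥-elim (cj≉0 (all-zero j))
    where
      all-zero : ∀ k → c k K.≈ K.0#
      all-zero zero = c₀≈0
      all-zero (suc k) = w-indep (c ∘ suc) (trans (sym (drop-zero-term c₀≈0 x _)) rel) k

  span-rescale : ∀ {m} (u v : Fin m → Carrier) κ → ¬ κ K.≈ K.0# → (∀ j → u j ≈ ι κ * v j) → Span u ≐ Span v
  span-rescale u v κ κ≉0 u≈κv =
    span-⊆ v u (λ j → span-resp v (sym (u≈κv j)) (span-scale v κ (span-gen v j))) ,
    span-⊆ u v (λ j → span-resp u (trans (*-congˡ (u≈κv j)) (ι-unscale κ κ≉0 (v j)))
                         (span-scale u (invK κ κ≉0) (span-gen u j)))

  second-nonzero : ∀ {x y} → LinIndep (vec2 x y) → ¬ y ≈ 0#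
  second-nonzero {x} {y} indep y≈0 = K-1≉0 (indep (K.0# ∷ K.1# ∷ λ ()) y-rel (suc zero))
    where
      y-rel : ι K.0# * x + (ι K.1# * y + 0#) ≈ 0#
      y-rel = trans (drop-zero-term K.refl x _) (trans (+-identityʳ _) (trans (*-congˡ y≈0) (zeroʳ _)))

  pair-annihilator : ∀ {X X' β} → X' ≈ X * β → LinIndep (vec2 X X') →
    ∀ a b → X * (ι a + ι b * β) ≈ 0# → a K.≈ K.0# × b K.≈ K.0#
  pair-annihilator {X} {X'} {β} X'≈Xβ indep a b X[a+bβ]≈0 = indep c rel zero , indep c rel (suc zero)
    where
      c : Fin 2 → Scalar
      c = a ∷ b ∷ λ ()
      rel : ι a * X + (ι b * X' + 0#) ≈ 0#
      rel = begin
        ι a * X + (ι b * X' + 0#) ≈⟨ +-congˡ (trans (+-identityʳ _) (*-congˡ X'≈Xβ)) ⟩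
        ι a * X + ι b * (X * β)   ≈⟨ pair-regroup (ι a) (ι b) X β ⟩
        X * (ι a + ι b * β)       ≈⟨ X[a+bβ]≈0 ⟩
        0#                        ∎

  -- Two planes inside the span of a dependent triple coincide: both equal the
  -- span of the two vectors left after dropping a redundant one.
  planes-in-dependent-triple : (C : Fin 3 → Carrier) (u v : Fin 2 → Carrier) → Dependent C →
    LinIndep u → LinIndep v → (∀ j → Span C (u j)) → (∀ j → Span C (v j)) → Span u ≐ Span v
  planes-in-dependent-triple C u v C-dep u-indep v-indep u∈C v∈C with drop-redundant C C-dep
  ... | j , C⊆S = u⊆v , v⊆u
    where
      S : Fin 2 → Carrier
      S = C ∘ punchIn j
      S⊆u : Span S ⊆ Span u
      S⊆u = independent-fills 2 u S u-indep (λ k → C⊆S (u k) (u∈C k))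
      S⊆v : Span S ⊆ Span v
      S⊆v = independent-fills 2 v S v-indep (λ k → C⊆S (v k) (v∈C k))
      u⊆v : Span u ⊆ Span v
      u⊆v = span-⊆ v u (λ k → S⊆v (u k) (C⊆S (u k) (u∈C k)))
      v⊆u : Span v ⊆ Span u
      v⊆u = span-⊆ u v (λ k → S⊆u (v k) (C⊆S (v k) (v∈C k)))

  geometric-triple : ∀ α i r {c} κ → ¬ κ K.≈ K.0# → c ≈ ι κ * pow α r →
    Span (vec3 c (c * pow α i) (c * pow α i * pow α i)) ≐
    Span (vec3 (pow α r) (pow α (r ℕ.+ i)) (pow α (r ℕ.+ i ℕ.+ i)))
  geometric-triple α i r {c} κ κ≉0 c≈καʳ =
    span-rescale (vec3 c (c * pow α i) (c * pow α i * pow α i))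
                 (vec3 (pow α r) (pow α (r ℕ.+ i)) (pow α (r ℕ.+ i ℕ.+ i))) κ κ≉0 λ
    { zero → c≈καʳ
    ; (suc zero) → shift r c≈καʳ
    ; (suc (suc zero)) → shift (r ℕ.+ i) (shift r c≈καʳ) }
    where
      shift : ∀ s {x} → x ≈ ι κ * pow α s → x * pow α i ≈ ι κ * pow α (s ℕ.+ i)
      shift s x≈καˢ = trans (*-congʳ x≈καˢ) (trans (*-assoc _ _ _) (*-congˡ (sym (pow-+ α s i))))

  reduce-exponent : ∀ {α} → ¬ α ≈ 0# → ∀ d .{{_ : NonZero d}} μ → pow α d ≈ ι μ → ∀ n →
    ∃ λ κ → ¬ κ K.≈ K.0# × pow α n ≈ ι κ * pow α (n % d)
  reduce-exponent {α} α≉0 d μ αᵈ≈μ n = κ , κ≉0 , αⁿ≈καʳ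
    where
      κ : Scalar
      κ = proj₁ (pow-ι μ (n / d))
      αⁿ≈καʳ : pow α n ≈ ι κ * pow α (n % d)
      αⁿ≈καʳ = begin
        pow α n                          ≡⟨ ≡.cong (pow α) (m≡m%n+[m/n]*n n d) ⟩
        pow α (n % d ℕ.+ (n / d) ℕ.* d)  ≈⟨ pow-+ α (n % d) _ ⟩
        pow α (n % d) * pow α ((n / d) ℕ.* d)  ≈⟨ *-congˡ (pow-* α (n / d) d) ⟩
        pow α (n % d) * pow (pow α d) (n / d)  ≈⟨ *-congˡ (pow-cong (n / d) αᵈ≈μ) ⟩
        pow α (n % d) * pow (ι μ) (n / d)      ≈⟨ *-congˡ (proj₂ (pow-ι μ (n / d))) ⟩
        pow α (n % d) * ι κ                    ≈⟨ *-comm _ _ ⟩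
        ι κ * pow α (n % d)              ∎
      κ≉0 : ¬ κ K.≈ K.0#
      κ≉0 κ≈0 = pow-nonzero α≉0 n (trans αⁿ≈καʳ (ι-zero-scale κ≈0 _))

  scalar-from-repetition : ∀ {α} → ¬ α ≈ 0# → ∀ a d κ (κ≉0 : ¬ κ K.≈ K.0#) →
    pow α a ≈ ι κ * pow α (a ℕ.+ d) → pow α d ≈ ι (invK κ κ≉0)
  scalar-from-repetition {α} α≉0 a d κ κ≉0 αᵃ≈καᵃ⁺ᵈ = begin
    pow α d                          ≈⟨ ι-unscale κ κ≉0 (pow α d) ⟨
    ι (invK κ κ≉0) * (ι κ * pow α d) ≈⟨ *-congˡ 1≈καᵈ ⟨
    ι (invK κ κ≉0) * 1#              ≈⟨ *-identityʳ _ ⟩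
    ι (invK κ κ≉0)                   ∎
    where
      1≈καᵈ : 1# ≈ ι κ * pow α d
      1≈καᵈ = *-cancelˡ-nonzero (pow-nonzero α≉0 a) (begin
        pow α a * 1#               ≈⟨ *-identityʳ _ ⟩
        pow α a                    ≈⟨ αᵃ≈καᵃ⁺ᵈ ⟩
        ι κ * pow α (a ℕ.+ d)      ≈⟨ *-congˡ (pow-+ α a d) ⟩
        ι κ * (pow α a * pow α d)  ≈⟨ x∙yz≈y∙xz (ι κ) (pow α a) (pow α d) ⟩
        pow α a * (ι κ * pow α d)  ∎)

  -- A nonzero vector is normalised by
  -- its first nonzero coordinate; the coordinates after it form a word over
  -- Fin q.  This codes the lines of Kᵐ injectively into Fin (lines m), where
  -- lines m = 1 + q + … + q^(m−1).
  module Lines (q : ℕ) (f : Fin q → Scalar) (f-onto : ∀ κ → ∃ λ i → f i K.≈ κ) where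

    lines : ℕ → ℕ
    lines zero = 0
    lines (suc m) = lines m ℕ.+ q ℕ.^ m

    lines-five : lines 5 ≡ sNum q
    lines-five = ≡.cong (λ x → 1 ℕ.+ x ℕ.+ q ℕ.^ 2 ℕ.+ q ℕ.^ 3 ℕ.+ q ℕ.^ 4) (ℕ.*-identityʳ q)

    index : Scalar → Fin q
    index κ = proj₁ (f-onto κ)

    index-injective : ∀ {κ μ} → index κ ≡ index μ → κ K.≈ μ
    index-injective {κ} {μ} same =
      K.trans (K.sym (proj₂ (f-onto κ))) (K.trans (K.reflexive (≡.cong f same)) (proj₂ (f-onto μ)))

    word : ∀ m → (Fin m → Fin q) → Fin (q ℕ.^ m)
    word zero _ = zero
    word (suc m) d = Fin.combine (d zero) (word m (d ∘ suc))

    word-injective : ∀ m d d' → word m d ≡ word m d' → ∀ k → d k ≡ d' k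
    word-injective (suc m) d d' same zero =
      Fin.combine-injectiveˡ (d zero) (word m (d ∘ suc)) (d' zero) (word m (d' ∘ suc)) same
    word-injective (suc m) d d' same (suc k) = word-injective m (d ∘ suc) (d' ∘ suc)
      (Fin.combine-injectiveʳ (d zero) (word m (d ∘ suc)) (d' zero) (word m (d' ∘ suc)) same) k

    join-injective : ∀ {m n} {a b : Fin m ⊎ Fin n} → Fin.join m n a ≡ Fin.join m n b → a ≡ b
    join-injective {m} {n} {a} {b} same =
      ≡.trans (≡.sym (Fin.splitAt-join m n a)) (≡.trans (≡.cong (Fin.splitAt m) same) (Fin.splitAt-join m n b))

    inj₂≢inj₁ : ∀ {a b} {A : Set a} {B : Set b} {x : A} {y : B} → inj₂ x ≢ inj₁ y
    inj₂≢inj₁ ()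

    NonZeroVec : ∀ {m} → (Fin m → Scalar) → Set _
    NonZeroVec c = ¬ (∀ k → c k K.≈ K.0#)

    Proportional : ∀ {m} → (Fin m → Scalar) → (Fin m → Scalar) → Set _
    Proportional c d = ∃ λ κ → ¬ κ K.≈ K.0# × ∀ k → c k K.≈ κ K.* d k

    lineCode : ∀ m (c : Fin m → Scalar) → NonZeroVec c → Fin (lines m)
    lineCode zero c c≉0 = ⊥-elim (c≉0 λ ())
    lineCode (suc m) c c≉0 with c zero ≟K K.0#
    ... | no c₀≉0 = Fin.join (lines m) (q ℕ.^ m) (inj₂ (word m λ k → index (c (suc k) K.* invK (c zero) c₀≉0)))
    ... | yes c₀≈0 = Fin.join (lines m) (q ℕ.^ m) (inj₁ (lineCode m (c ∘ suc) tail≉0))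
      where
        tail≉0 : NonZeroVec (c ∘ suc)
        tail≉0 c'≈0 = c≉0 λ { zero → c₀≈0 ; (suc k) → c'≈0 k }

    same-normal-form : ∀ {m} (c d : Fin (suc m) → Scalar) (c₀≉0 : ¬ c zero K.≈ K.0#) (d₀≉0 : ¬ d zero K.≈ K.0#) →
      (∀ k → c (suc k) K.* invK (c zero) c₀≉0 K.≈ d (suc k) K.* invK (d zero) d₀≉0) → Proportional c d
    same-normal-form c d c₀≉0 d₀≉0 same = κ , κ≉0 , c≈κd
      where
        d₀⁻¹ κ : Scalar
        d₀⁻¹ = invK (d zero) d₀≉0
        κ = c zero K.* d₀⁻¹
        κd₀≈c₀ : κ K.* d zero K.≈ c zero
        κd₀≈c₀ = K-unnormalise (c zero) (d zero) d₀≉0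
        κ≉0 : ¬ κ K.≈ K.0#
        κ≉0 κ≈0 = c₀≉0 (K.trans (K.sym κd₀≈c₀) (K.trans (K.*-congʳ κ≈0) (K.zeroˡ _)))
        c≈κd : ∀ k → c k K.≈ κ K.* d k
        c≈κd zero = K.sym κd₀≈c₀
        c≈κd (suc k) = K.trans (K.sym (K-unnormalise (c (suc k)) (c zero) c₀≉0))
          (K.trans (K.*-congʳ (same k)) (K-comm.xy∙z≈zy∙x (d (suc k)) d₀⁻¹ (c zero)))
          where module K-comm = CommutativeSemigroupProperties K.*-commutativeSemigroup

    lineCode-proportional : ∀ m c d (c≉0 : NonZeroVec c) (d≉0 : NonZeroVec d) →
      lineCode m c c≉0 ≡ lineCode m d d≉0 → Proportional c d
    lineCode-proportional zero c d c≉0 d≉0 same = ⊥-elim (c≉0 λ ())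
    lineCode-proportional (suc m) c d c≉0 d≉0 same with c zero ≟K K.0# | d zero ≟K K.0#
    ... | no c₀≉0 | no d₀≉0 = same-normal-form c d c₀≉0 d₀≉0
          (λ k → index-injective (word-injective m _ _ (Sum.inj₂-injective (join-injective same)) k))
    ... | no _ | yes _ = ⊥-elim (inj₂≢inj₁ (join-injective same))
    ... | yes _ | no _ = ⊥-elim (inj₂≢inj₁ (≡.sym (join-injective same)))
    ... | yes c₀≈0 | yes d₀≈0
      with lineCode-proportional m (c ∘ suc) (d ∘ suc) _ _ (Sum.inj₁-injective (join-injective same))
    ...   | κ , κ≉0 , c'≈κd' = κ , κ≉0 , λ
      { zero → K.trans c₀≈0 (K.sym (K.trans (K.*-congˡ d₀≈0) (K.zeroʳ κ)))
      ; (suc k) → c'≈κd' k }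

    module _ {m} (e : Fin m → Carrier) (e-spans : ∀ x → Span e x) where

      coordinates : Carrier → Fin m → Scalar
      coordinates x = proj₁ (e-spans x)

      coordinates-nonzero : ∀ {x} → ¬ x ≈ 0# → NonZeroVec (coordinates x)
      coordinates-nonzero {x} x≉0 all≈0 = x≉0 (trans (proj₂ (e-spans x)) (lc-zero (coordinates x) e all≈0))

      pointCode : (x : Carrier) → ¬ x ≈ 0# → Fin (lines m)
      pointCode x x≉0 = lineCode m (coordinates x) (coordinates-nonzero x≉0)

      same-point : ∀ {x y} (x≉0 : ¬ x ≈ 0#) (y≉0 : ¬ y ≈ 0#) →
        pointCode x x≉0 ≡ pointCode y y≉0 → ∃ λ κ → ¬ κ K.≈ K.0# × x ≈ ι κ * y
      same-point {x} {y} x≉0 y≉0 same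
        with lineCode-proportional m _ _ (coordinates-nonzero x≉0) (coordinates-nonzero y≉0) same
      ... | κ , κ≉0 , cx≈κcy = κ , κ≉0 , (begin
        x                                            ≈⟨ proj₂ (e-spans x) ⟩
        lincomb (coordinates x) e                    ≈⟨ lc-cong cx≈κcy (λ _ → refl) ⟩
        lincomb (λ k → κ K.* coordinates y k) e      ≈⟨ lc-scale κ (coordinates y) e ⟩
        ι κ * lincomb (coordinates y) e              ≈⟨ *-congˡ (proj₂ (e-spans y)) ⟨
        ι κ * y                                      ∎)

      -- Pigeonhole: two of α⁰, …, α^(lines m) lie on the same line, so some α^d
      -- with 0 < d ≤ lines m is a scalar.
      powerCode : ∀ {α} → ¬ α ≈ 0# → Fin (suc (lines m)) → Fin (lines m)
      powerCode {α} α≉0 i = pointCode (pow α (Fin.toℕ i)) (pow-nonzero α≉0 (Fin.toℕ i))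

      scalar-power : ∀ {α} → ¬ α ≈ 0# → ∃ λ d → 0 ℕ.< d × d ℕ.≤ lines m × ∃ λ μ → pow α d ≈ ι μ
      scalar-power {α} α≉0 with Fin.pigeonhole (ℕ.n<1+n (lines m)) (powerCode α≉0)
      ... | i , j , i<j , same-code
        with same-point (pow-nonzero α≉0 (Fin.toℕ i)) (pow-nonzero α≉0 (Fin.toℕ j)) same-code
      ...   | κ , κ≉0 , αᵃ≈καᵇ =
        b ℕ.∸ a , ℕ.m<n⇒0<n∸m i<j , ℕ.≤-trans (ℕ.m∸n≤m b a) (ℕ.≤-pred (Fin.toℕ<n j)) ,
        invK κ κ≉0 , scalar-from-repetition α≉0 a (b ℕ.∸ a) κ κ≉0 (trans αᵃ≈καᵇ (*-congˡ αᵇ≈αᵃ⁺ᵈ))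
        where
          a b : ℕ
          a = Fin.toℕ i
          b = Fin.toℕ j
          αᵇ≈αᵃ⁺ᵈ : pow α b ≈ pow α (a ℕ.+ (b ℕ.∸ a))
          αᵇ≈αᵃ⁺ᵈ = reflexive (≡.cong (pow α) (≡.sym (ℕ.m+[n∸m]≡n (ℕ.<⇒≤ i<j))))

      power-normal-form : ∀ {α} → ¬ α ≈ 0# → ∀ n →
        ∃ λ r → r ℕ.< lines m × ∃ λ κ → ¬ κ K.≈ K.0# × pow α n ≈ ι κ * pow α r
      power-normal-form α≉0 n with scalar-power α≉0
      ... | d , 0<d , d≤lines , μ , αᵈ≈μ =
        n % d , ℕ.<-≤-trans (m%n<n n d) d≤lines , reduce-exponent α≉0 d μ αᵈ≈μ n
        where instance
          d≢0 : NonZero d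
          d≢0 = ℕ.>-nonZero 0<d

      primitive-normal-form : ∀ {α} → IsPrimitive α → ¬ α ≈ 0# → ∀ c → ¬ c ≈ 0# →
        ∃ λ r → r ℕ.< lines m × ∃ λ κ → ¬ κ K.≈ K.0# × c ≈ ι κ * pow α r
      primitive-normal-form α-primitive α≉0 c c≉0 with α-primitive c c≉0
      ... | n , c≈αⁿ with power-normal-form α≉0 n
      ...   | r , r<lines , κ , κ≉0 , αⁿ≈καʳ = r , r<lines , κ , κ≉0 , trans c≈αⁿ αⁿ≈καʳ

  module TwoPlanes (A A' B B' β : Carrier) (A'≈Aβ : A' ≈ A * β) (B'≈Bβ : B' ≈ B * β)
    (A-indep : LinIndep (vec2 A A')) (B-indep : LinIndep (vec2 B B'))
    (distinct : ¬ (Span (vec2 A A') ≐ Span (vec2 B B')))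
    (z : Fin 3 → Carrier) (planeA⊆z : Span (vec2 A A') ⊆ Span z) (planeB⊆z : Span (vec2 B B') ⊆ Span z)
    where

    planeA planeB : Fin 2 → Carrier
    planeA = vec2 A A'
    planeB = vec2 B B'

    A∈z : Span z A
    A∈z = planeA⊆z A (span-gen planeA zero)
    A'∈z : Span z A'
    A'∈z = planeA⊆z A' (span-gen planeA (suc zero))
    B∈z : Span z B
    B∈z = planeB⊆z B (span-gen planeB zero)
    B'∈z : Span z B'
    B'∈z = planeB⊆z B' (span-gen planeB (suc zero))

    four : Fin 4 → Carrier
    four = A ∷ A' ∷ B ∷ B' ∷ λ ()

    relation : Dependent four
    relation = exchange 3 z four λ
      { zero → A∈z ; (suc zero) → A'∈z ; (suc (suc zero)) → B∈z ; (suc (suc (suc zero))) → B'∈z }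

    k : Fin 4 → Scalar
    k = proj₁ relation

    k-nontrivial : ¬ (∀ j → k j K.≈ K.0#)
    k-nontrivial k≈0 = proj₂ (proj₂ (proj₂ relation)) (k≈0 (proj₁ (proj₂ (proj₂ relation))))

    k₀ k₁ k₂ k₃ : Scalar
    k₀ = k zero
    k₁ = k (suc zero)
    k₂ = k (suc (suc zero))
    k₃ = k (suc (suc (suc zero)))

    P Q : Carrier
    P = ι k₀ + ι k₁ * β
    Q = ι k₂ + ι k₃ * β

    AP+BQ≈0 : A * P + B * Q ≈ 0#
    AP+BQ≈0 = begin
      A * P + B * Q ≈⟨ regroup (ι k₀) (ι k₁) (ι k₂) (ι k₃) A B β ⟨
      ι k₀ * A + (ι k₁ * (A * β) + (ι k₂ * B + ι k₃ * (B * β)))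
        ≈⟨ +-congˡ (+-cong (*-congˡ (sym A'≈Aβ)) (+-congˡ (trans (*-congˡ (sym B'≈Bβ)) (sym (+-identityʳ _))))) ⟩
      lincomb k four ≈⟨ proj₁ (proj₂ relation) ⟩
      0# ∎
      where
        regroup : ∀ a b c d x y t →
          a * x + (b * (x * t) + (c * y + d * (y * t))) ≈ x * (a + b * t) + y * (c + d * t)
        regroup = solve 7 (λ a b c d x y t →
          a :* x :+ (b :* (x :* t) :+ (c :* y :+ d :* (y :* t))) := x :* (a :+ b :* t) :+ y :* (c :+ d :* t)) refl

    -- A·P = 0 would give B·Q = 0 too, and the independent pairs would force k = 0.
    AP≉0 : ¬ A * P ≈ 0#
    AP≉0 AP≈0 = k-nontrivial λ
      { zero → proj₁ k₀,k₁≈0 ; (suc zero) → proj₂ k₀,k₁≈0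
      ; (suc (suc zero)) → proj₁ k₂,k₃≈0 ; (suc (suc (suc zero))) → proj₂ k₂,k₃≈0 }
      where
        k₀,k₁≈0 : k₀ K.≈ K.0# × k₁ K.≈ K.0#
        k₀,k₁≈0 = pair-annihilator A'≈Aβ A-indep k₀ k₁ AP≈0
        BQ≈0 : B * Q ≈ 0#
        BQ≈0 = trans (sym (+-identityˡ _)) (trans (+-congʳ (sym AP≈0)) AP+BQ≈0)
        k₂,k₃≈0 : k₂ K.≈ K.0# × k₃ K.≈ K.0#
        k₂,k₃≈0 = pair-annihilator B'≈Bβ B-indep k₂ k₃ BQ≈0

    affine-zero : ∀ {a b} → a K.≈ K.0# → b K.≈ K.0# → ι a + ι b * β ≈ 0#
    affine-zero a≈0 b≈0 = trans (+-cong (trans (ι-cong a≈0) ι-0) (ι-zero-scale b≈0 β)) (+-identityʳ 0#)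

    P≉0 : ¬ P ≈ 0#
    P≉0 P≈0 = AP≉0 (trans (*-congˡ P≈0) (zeroʳ A))

    Q≉0 : ¬ Q ≈ 0#
    Q≉0 Q≈0 = AP≉0 (trans (sym (+-identityʳ _)) (trans (+-congˡ (sym (trans (*-congˡ Q≈0) (zeroʳ B)))) AP+BQ≈0))

    c : Carrier
    c = A * invL Q Q≉0

    cQ≈A : c * Q ≈ A
    cQ≈A = trans (*-assoc A _ Q) (trans (*-congˡ (trans (*-comm _ Q) (invL-r Q Q≉0))) (*-identityʳ A))

    -cP≈B : - (c * P) ≈ B
    -cP≈B = begin
      - ((A * invL Q Q≉0) * P) ≈⟨ -‿cong (xy∙z≈xz∙y A _ P) ⟩
      - ((A * P) * invL Q Q≉0) ≈⟨ -‿cong (*-congʳ (inverseˡ-unique _ _ AP+BQ≈0)) ⟩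
      - (- (B * Q) * invL Q Q≉0) ≈⟨ -‿cong (-‿distribˡ-* _ _) ⟨
      - - ((B * Q) * invL Q Q≉0) ≈⟨ ⁻¹-involutive _ ⟩
      (B * Q) * invL Q Q≉0      ≈⟨ trans (*-assoc B Q _) (trans (*-congˡ (invL-r Q Q≉0)) (*-identityʳ B)) ⟩
      B                         ∎

    c≉0 : ¬ c ≈ 0#
    c≉0 c≈0 = AP≉0 (trans (*-congʳ A≈0) (zeroˡ P))
      where
        A≈0 : A ≈ 0#
        A≈0 = trans (sym cQ≈A) (trans (*-congʳ c≈0) (zeroˡ Q))

    cβQ≈A' : (c * β) * Q ≈ A'
    cβQ≈A' = trans (xy∙z≈xz∙y c β Q) (trans (*-congʳ cQ≈A) (sym A'≈Aβ))

    -cβP≈B' : - ((c * β) * P) ≈ B'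
    -cβP≈B' = trans (-‿cong (xy∙z≈xz∙y c β P)) (trans (-‿distribˡ-* _ _) (trans (*-congʳ -cP≈B) (sym B'≈Bβ)))

    cQ∈z : Span z (c * Q)
    cQ∈z = span-resp z (sym cQ≈A) A∈z
    cP∈z : Span z (c * P)
    cP∈z = span-unneg z (span-resp z (sym -cP≈B) B∈z)
    cβQ∈z : Span z ((c * β) * Q)
    cβQ∈z = span-resp z (sym cβQ≈A') A'∈z
    cβP∈z : Span z ((c * β) * P)
    cβP∈z = span-unneg z (span-resp z (sym -cβP≈B') B'∈z)

    -- Both planes lie in ⟨C⟩, C = (c, cβ, cβ²), so C is independent.
    C : Fin 3 → Carrier
    C = vec3 c (c * β) (c * β * β)

    planeA⊆C : ∀ j → Span C (planeA j)
    planeA⊆C zero = span-resp C cQ≈A (span-affine C (span-gen C zero) (span-gen C (suc zero)) k₂ k₃)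
    planeA⊆C (suc zero) =
      span-resp C cβQ≈A' (span-affine C (span-gen C (suc zero)) (span-gen C (suc (suc zero))) k₂ k₃)

    planeB⊆C : ∀ j → Span C (planeB j)
    planeB⊆C zero = span-resp C -cP≈B (span-neg C (span-affine C (span-gen C zero) (span-gen C (suc zero)) k₀ k₁))
    planeB⊆C (suc zero) =
      span-resp C -cβP≈B' (span-neg C (span-affine C (span-gen C (suc zero)) (span-gen C (suc (suc zero))) k₀ k₁))

    C-indep : LinIndep C
    C-indep = ¬dependent⇒independent C λ C-dep →
      distinct (planes-in-dependent-triple C planeA planeB C-dep A-indep B-indep planeA⊆C planeB⊆C)

    D : Scalar
    D = k₀ K.* k₃ K.- k₁ K.* k₂

    ιD-distrib : ∀ x → ι D * x ≈ (ι k₀ * ι k₃) * x - (ι k₁ * ι k₂) * x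
    ιD-distrib x = begin
      ι D * x
        ≈⟨ *-congʳ (trans (ι-+ _ _) (+-cong (ι-* k₀ k₃) (trans (ι-neg _) (-‿cong (ι-* k₁ k₂))))) ⟩
      (ι k₀ * ι k₃ - ι k₁ * ι k₂) * x        ≈⟨ distribʳ x _ _ ⟩
      (ι k₀ * ι k₃) * x + - (ι k₁ * ι k₂) * x ≈⟨ +-congˡ (-‿distribˡ-* _ _) ⟨
      (ι k₀ * ι k₃) * x - (ι k₁ * ι k₂) * x  ∎

    D-x : ∀ x → ι D * x ≈ ι k₃ * (x * P) - ι k₁ * (x * Q)
    D-x x = trans (ιD-distrib x) (move-terms _ _ _ _ (regroup (ι k₀) (ι k₁) (ι k₂) (ι k₃) x β))
      where
        regroup : ∀ a b c d x t → (a * d) * x + b * (x * (c + d * t)) ≈ d * (x * (a + b * t)) + (b * c) * x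
        regroup = solve 6 (λ a b c d x t →
          (a :* d) :* x :+ b :* (x :* (c :+ d :* t)) := d :* (x :* (a :+ b :* t)) :+ (b :* c) :* x) refl

    D-xβ : ∀ x → ι D * (x * β) ≈ ι k₀ * (x * Q) - ι k₂ * (x * P)
    D-xβ x = trans (ιD-distrib (x * β)) (move-terms _ _ _ _ (regroup (ι k₀) (ι k₁) (ι k₂) (ι k₃) x β))
      where
        regroup : ∀ a b c d x t →
          (a * d) * (x * t) + c * (x * (a + b * t)) ≈ a * (x * (c + d * t)) + (b * c) * (x * t)
        regroup = solve 6 (λ a b c d x t →
          (a :* d) :* (x :* t) :+ c :* (x :* (a :+ b :* t)) := a :* (x :* (c :+ d :* t)) :+ (b :* c) :* (x :* t)) refl

    -- D = 0 would make x·P and x·Q lie in the same subspaces, so the planes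
    -- ⟨cQ, cβQ⟩ and ⟨cP, cβP⟩ would coincide.
    D≉0 : ¬ D K.≈ K.0#
    D≉0 D≈0 = distinct (planeA⊆planeB , planeB⊆planeA)
      where
        k₃xP≈k₁xQ : ∀ x → ι k₃ * (x * P) ≈ ι k₁ * (x * Q)
        k₃xP≈k₁xQ x = x∙y⁻¹≈ε⇒x≈y _ _ (trans (sym (D-x x)) (ι-zero-scale D≈0 x))
        k₀xQ≈k₂xP : ∀ x → ι k₀ * (x * Q) ≈ ι k₂ * (x * P)
        k₀xQ≈k₂xP x = x∙y⁻¹≈ε⇒x≈y _ _ (trans (sym (D-xβ x)) (ι-zero-scale D≈0 (x * β)))
        P-coefficients : ¬ (k₁ K.≈ K.0# × k₀ K.≈ K.0#)
        P-coefficients (k₁≈0 , k₀≈0) = P≉0 (affine-zero k₀≈0 k₁≈0)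
        Q-coefficients : ¬ (k₃ K.≈ K.0# × k₂ K.≈ K.0#)
        Q-coefficients (k₃≈0 , k₂≈0) = Q≉0 (affine-zero k₂≈0 k₃≈0)
        P⇒Q : ∀ S x → Span S (x * P) → Span S (x * Q)
        P⇒Q S x = span-transfer S k₁ k₃ k₀ k₂ (sym (k₃xP≈k₁xQ x)) (k₀xQ≈k₂xP x) P-coefficients
        Q⇒P : ∀ S x → Span S (x * Q) → Span S (x * P)
        Q⇒P S x = span-transfer S k₃ k₁ k₂ k₀ (k₃xP≈k₁xQ x) (sym (k₀xQ≈k₂xP x)) Q-coefficients
        planeA⊆planeB : Span planeA ⊆ Span planeB
        planeA⊆planeB = span-⊆ planeB planeA λ
          { zero → span-resp planeB cQ≈A
              (P⇒Q planeB c (span-unneg planeB (span-resp planeB (sym -cP≈B) (span-gen planeB zero))))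
          ; (suc zero) → span-resp planeB cβQ≈A'
              (P⇒Q planeB (c * β) (span-unneg planeB (span-resp planeB (sym -cβP≈B') (span-gen planeB (suc zero))))) }
        planeB⊆planeA : Span planeB ⊆ Span planeA
        planeB⊆planeA = span-⊆ planeA planeB λ
          { zero → span-resp planeA -cP≈B
              (span-neg planeA (Q⇒P planeA c (span-resp planeA (sym cQ≈A) (span-gen planeA zero))))
          ; (suc zero) → span-resp planeA -cβP≈B'
              (span-neg planeA (Q⇒P planeA (c * β) (span-resp planeA (sym cβQ≈A') (span-gen planeA (suc zero))))) }

    -- Since D ≠ 0, each vector of C is a combination of cP, cQ, cβP, cβQ ∈ ⟨z⟩.
    C⊆z : ∀ j → Span z (C j)
    C⊆z zero = span-unscale z D D≉0 (span-resp z (sym (D-x c)) (span-combination z k₃ k₁ cP∈z cQ∈z))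
    C⊆z (suc zero) = span-unscale z D D≉0 (span-resp z (sym (D-xβ c)) (span-combination z k₀ k₂ cQ∈z cP∈z))
    C⊆z (suc (suc zero)) =
      span-unscale z D D≉0 (span-resp z (sym (D-xβ (c * β))) (span-combination z k₀ k₂ cβQ∈z cβP∈z))

    -- Three independent vectors in ⟨z⟩ span it.
    solid : Span z ≐ Span C
    solid = independent-fills 3 C z C-indep C⊆z , span-⊆ z C C⊆z

open import Data.Nat using (_+_; _≤_; _∸_)
open import Data.Unit using (⊤; tt)

lemma8 : ∀ {k₁ k₂ l₁ l₂ z : Level} (q : ℕ) → IsPrimePower q →
    (E : FieldExt k₁ k₂ l₁ l₂) →
    let open FieldExt E in
    let open LinAlg E in
    HasCard K q →
    IsSubspaceOfDim (λ _ → ⊤) 5 →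
    (α : CommutativeRing.Carrier L) → IsPrimitive α →
    (i : ℕ) → 1 ≤ i → i ≤ sNum q ∸ 1 →
    (t ℓ : ℕ) → (Z : CommutativeRing.Carrier L → Set z) →
    IsSubspaceOfDim (Span (vec2 (pow α t) (pow α (t + i)))) 2 →
    IsSubspaceOfDim (Span (vec2 (pow α ℓ) (pow α (ℓ + i)))) 2 →
    ¬ (Span (vec2 (pow α t) (pow α (t + i))) ≐ Span (vec2 (pow α ℓ) (pow α (ℓ + i)))) →
    IsSubspaceOfDim Z 3 →
    Span (vec2 (pow α t) (pow α (t + i))) ⊆ Z →
    Span (vec2 (pow α ℓ) (pow α (ℓ + i))) ⊆ Z →
    ∃ λ r → r ≤ sNum q ∸ 1 ×
    (Z ≐ Span (vec3 (pow α r) (pow α (r + i)) (pow α (r + i + i))))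
lemma8 q _ E card (e , _ , L⊆e , _) α α-primitive i 1≤i _ t ℓ Z plane₁ plane₂ distinct
       (z , _ , Z⊆z , z⊆Z) sub₁ sub₂ =
  conclude (primitive-normal-form e (λ x → L⊆e x tt) α-primitive α≉0 Planes.c Planes.c≉0)
  where
    open FieldExt E using (ι)
    open LinAlg E using (module K; pow; vec2; vec3; Span; LinIndep; _≐_)
    open CommutativeRing (FieldExt.L E) using (_≈_; _*_; 0#)
    open Theory E (finite⇒decidable (FieldExt.K E) q card)
    open Lines q (proj₁ card) (proj₂ (proj₂ card))

    A-indep : LinIndep (vec2 (pow α t) (pow α (t + i)))
    A-indep = spanning⇒independent (vec2 (pow α t) (pow α (t + i))) plane₁
    B-indep : LinIndep (vec2 (pow α ℓ) (pow α (ℓ + i)))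
    B-indep = spanning⇒independent (vec2 (pow α ℓ) (pow α (ℓ + i))) plane₂
    α≉0 : ¬ α ≈ 0#
    α≉0 α≈0 = second-nonzero A-indep (pow-of-zero α≈0 (t + i) (ℕ.≤-trans 1≤i (ℕ.m≤n+m i t)))

    module Planes = TwoPlanes (pow α t) (pow α (t + i)) (pow α ℓ) (pow α (ℓ + i)) (pow α i)
      (pow-+ α t i) (pow-+ α ℓ i) A-indep B-indep distinct
      z (λ x → Z⊆z x ∘ sub₁ x) (λ x → Z⊆z x ∘ sub₂ x)

    -- Writing c = κ·αʳ with r < lines 5 = s turns ⟨c, cβ, cβ²⟩ into the claimed solid.
    conclude : (∃ λ r → r ℕ.< lines 5 × ∃ λ κ → ¬ κ K.≈ K.0# × Planes.c ≈ ι κ * pow α r) →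
      ∃ λ r → r ≤ sNum q ∸ 1 × (Z ≐ Span (vec3 (pow α r) (pow α (r + i)) (pow α (r + i + i))))
    conclude (r , r<lines , κ , κ≉0 , c≈καʳ) =
      r , ℕ.<⇒≤pred (≡.subst (r ℕ.<_) lines-five r<lines) ,
      ≐-trans (Z⊆z , z⊆Z) (≐-trans Planes.solid (geometric-triple α i r κ κ≉0 c≈καʳ))
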